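{- Let $\theta = p/q \in (0,1]$, where $p$ and $q$ are positive integers such that $p$ divides $q+1$, and let $(a_i)_{i=1}^\infty$ be the infinite greedy underapproximation sequence of $\theta$. For every positive integer $n$, if $(x_i)_{i=1}^n$ is a sequence of integers with $2 \leq x_1 \leq \cdots \leq x_n$ such that \[ \sum_{i=1}^n \frac{1}{a_i} \leq \sum_{i=1}^n \frac{1}{x_i} < \frac{p}{q}, \] then $x_i = a_i$ for all $i = 1,\ldots,n$.
   Context: For $\theta \in (0,1]$ let $G(\theta) = \lfloor 1/\theta \rfloor + 1$; equivalently $G(\theta)$ is the unique integer $a \geq 2$ with $1/a < \theta \leq 1/(a-1)$. The infinite greedy underapproximation sequence $(a_i)_{i=1}^\infty$ of $\theta\in(0,1]$ is defined by $a_1 = G(\theta)$ and $a_{i+1} = G\left(\theta - \sum_{j=1}^i \frac{1}{a_j}\right)$ for all $i \geq 1$. -}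

module Defs where

open import Data.Nat as ℕ using (ℕ; zero; suc)
open import Data.Nat.DivMod using (_/_)
open import Data.Integer using (∣_∣)
open import Data.Rational using (ℚ; ↥_; ↧ₙ_; _-_; _+_; 0ℚ; 1/_)
import Data.Rational as Q

-- G(θ) = ⌊1/θ⌋ + 1.  For θ = n/d in lowest terms with n > 0 this is
-- ⌊d/n⌋ + 1.  (For θ = 0, which never occurs in the sequences below since
-- θ ∈ (0,1] and every remainder stays positive, we return 1 arbitrarily;
-- negative θ also never occurs.)
G : ℚ → ℕ
G θ with ∣ ↥ θ ∣
... | zero  = 1
... | suc k = suc ((↧ₙ θ) / suc k)

-- reciprocal of a natural number as a rational (1/0 := 0, never used with 0)
inv : ℕ → ℚ
inv zero    = 0ℚ
inv (suc k) = Q._/_ (Data.Integer.+ 1) (suc k)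
  where import Data.Integer

partialSum : (ℕ → ℕ) → ℕ → ℚ
partialSum f zero    = 0ℚ
partialSum f (suc i) = partialSum f i + inv (f (suc i))

-- greedy underapproximation sequence, indexed from 1:
-- a(1) = G θ,  a(i+1) = G (θ - Σ_{j≤i} 1/a(j));  a(0) is a dummy value.
-- remainder after i terms
greedyRem : ℚ → ℕ → ℚ
greedyRem θ zero    = θ
greedyRem θ (suc i) = greedyRem θ i - inv (G (greedyRem θ i))

greedy : ℚ → ℕ → ℕ
greedy θ zero    = 0
greedy θ (suc i) = G (greedyRem θ i)

-- For θ = p/q with q + 1 = cp every greedy remainder is a unit fraction: a₁ = c,
-- aₖ₊₁ = q a₁⋯aₖ + 1 and θ = ∑_{i≤k} 1/aᵢ + 1/(q a₁⋯aₖ).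
-- Suppose m is the last index with x₁⋯xₘ < a₁⋯aₘ. The sum ∑_{i≤m} 1/xᵢ < θ has denominator
-- x₁⋯xₘ, so it is at most θ - 1/(q x₁⋯xₘ) < ∑_{i≤m} 1/aᵢ. Beyond m the prefix products of x
-- dominate those of a, and for nondecreasing x this gives ∑ 1/xᵢ ≤ ∑ 1/aᵢ: write
-- 1/aᵢ - 1/xᵢ = (1/xᵢ)(xᵢ/aᵢ - 1) and use Abel summation with the nonincreasing weights 1/xᵢ
-- together with AM-GM for the ratios xᵢ/aᵢ, whose prefix products are ≥ 1. So such an m
-- would give ∑ 1/xᵢ < ∑ 1/aᵢ. Hence there is none, so ∑ 1/xᵢ = ∑ 1/aᵢ, and the equality case
-- of AM-GM gives x = a.

module Submission where

open import Defs
open import Data.Nat using (ℕ; suc; _≤_; _<_; NonZero)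
open import Data.Nat.Divisibility using (_∣_)
open import Data.Integer using (+_)
open import Data.Rational using (ℚ; _/_)
import Data.Rational as Q
open import Relation.Binary.PropositionalEquality using (_≡_)

open import Data.Nat using (zero; _+_; _*_; _∸_; s≤s; z≤n)
import Data.Nat as ℕ
import Data.Nat.Properties as ℕP
import Data.Nat.DivMod as ℕD
open import Data.Nat.Divisibility using (divides; ∣-trans; ∣m+n∣m⇒∣n; ∣1⇒≡1)
open import Data.Nat.Coprimality using (Coprime; 1-coprimeTo)
open import Data.Nat.Tactic.RingSolver using (solve-∀)
import Data.Integer as ℤ
open import Data.Integer using (∣_∣)
import Data.Integer.Properties as ℤP
open import Data.Rational using (0ℚ; 1ℚ; ↥_)
import Data.Rational.Properties as QP
open import Data.Rational.Solver using (module +-*-Solver)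
import Data.Rational.Unnormalised as U
import Data.Rational.Unnormalised.Properties as UP
open import Data.Empty using (⊥-elim)
open import Data.Product using (∃-syntax; _×_; _,_; proj₁; proj₂)
open import Data.Sum using (_⊎_; inj₁; inj₂)
open import Function using (_∘_; const)
open import Relation.Binary.Definitions using (Reflexive; Transitive; tri<; tri≈; tri>)
open import Relation.Binary.PropositionalEquality
  using (_≢_; refl; sym; trans; cong; cong₂; subst; subst₂; module ≡-Reasoning)
open import Relation.Nullary using (¬_; yes; no)
open import Relation.Unary using (Decidable)

open +-*-Solver

Upto : ℕ → (ℕ → Set) → Set
Upto n P = ∀ i → 1 ≤ i → i ≤ n → P i

private variable
  n : ℕ
  P : ℕ → Set

upto-zero : Upto 0 P
upto-zero (suc i) _ ()

upto-init : Upto (suc n) P → Upto n P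
upto-init all i 1≤i i≤n = all i 1≤i (ℕP.m≤n⇒m≤1+n i≤n)

upto-last : Upto (suc n) P → P (suc n)
upto-last all = all _ (s≤s z≤n) ℕP.≤-refl

upto-snoc : Upto n P → P (suc n) → Upto (suc n) P
upto-snoc all p i 1≤i i≤1+n with ℕP.m≤n⇒m<n∨m≡n i≤1+n
... | inj₁ i<1+n = all i 1≤i (ℕP.≤-pred i<1+n)
... | inj₂ refl  = p

upto-take : ∀ {m} → m ≤ n → Upto n P → Upto m P
upto-take m≤n all i 1≤i i≤m = all i 1≤i (ℕP.≤-trans i≤m m≤n)

upto-drop : ∀ m L → m + L ≤ n → Upto n P → Upto L (λ i → P (m + i))
upto-drop m L m+L≤n all i 1≤i i≤L =
  all (m + i) (ℕP.≤-trans 1≤i (ℕP.m≤n+m i m)) (ℕP.≤-trans (ℕP.+-monoʳ-≤ m i≤L) m+L≤n)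

search-last : Decidable P → ∀ n →
  (∃[ m ] 1 ≤ m × m ≤ n × P m × (∀ k → m < k → k ≤ n → ¬ P k)) ⊎ Upto n (λ i → ¬ P i)
search-last P? zero = inj₂ upto-zero
search-last {P = P} P? (suc n) with P? (suc n)
... | yes p = inj₁ (suc n , s≤s z≤n , ℕP.≤-refl , p , λ k 1+n<k k≤1+n → ⊥-elim (ℕP.<⇒≱ 1+n<k k≤1+n))
... | no ¬p with search-last P? n
...   | inj₂ none = inj₂ (upto-snoc none ¬p)
...   | inj₁ (m , 1≤m , m≤n , pm , above) = inj₁ (m , 1≤m , ℕP.m≤n⇒m≤1+n m≤n , pm , above′)
  where
  above′ : ∀ k → m < k → k ≤ suc n → ¬ P k
  above′ k m<k k≤1+n with ℕP.m≤n⇒m<n∨m≡n k≤1+n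
  ... | inj₁ k<1+n = above k m<k (ℕP.≤-pred k<1+n)
  ... | inj₂ refl  = ¬p

search : Decidable P → ∀ n → (∃[ i ] 1 ≤ i × i ≤ n × P i) ⊎ Upto n (λ i → ¬ P i)
search P? n with search-last P? n
... | inj₁ (m , 1≤m , m≤n , pm , _) = inj₁ (m , 1≤m , m≤n , pm)
... | inj₂ none = inj₂ none

ChainUpto : {A : Set} → (A → A → Set) → ℕ → (ℕ → A) → Set
ChainUpto _R_ n f = ∀ i → 1 ≤ i → i < n → f i R f (suc i)

chainUpto⇒related : ∀ {A : Set} (_R_ : A → A → Set) → Reflexive _R_ → Transitive _R_ →
  ∀ n f → ChainUpto _R_ n f → ∀ i j → 1 ≤ i → i ≤ j → j ≤ n → f i R f j
chainUpto⇒related _R_ refl′ trans′ n f f↑ i j 1≤i i≤j j≤n with ℕP.m≤n⇒m<n∨m≡n i≤j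
... | inj₂ refl = refl′
chainUpto⇒related _R_ refl′ trans′ n f f↑ i (suc j) 1≤i i≤j j<n | inj₁ i<1+j = trans′
  (chainUpto⇒related _R_ refl′ trans′ n f f↑ i j 1≤i (ℕP.≤-pred i<1+j) (ℕP.<⇒≤ j<n))
  (f↑ j (ℕP.≤-trans 1≤i (ℕP.≤-pred i<1+j)) j<n)

chainUpto-drop : ∀ {A : Set} (_R_ : A → A → Set) n m L f → m + L ≤ n → ChainUpto _R_ n f →
  ChainUpto _R_ L (λ i → f (m + i))
chainUpto-drop _R_ n m L f m+L≤n f↑ i 1≤i i<L = subst (f (m + i) R_) (cong f (sym (ℕP.+-suc m i)))
  (f↑ (m + i) (ℕP.≤-trans 1≤i (ℕP.m≤n+m i m))
    (ℕP.≤-trans (subst (_≤ m + L) (ℕP.+-suc m i) (ℕP.+-monoʳ-≤ m i<L)) m+L≤n))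

p≤q⇒0≤q-p : ∀ {p q} → p Q.≤ q → 0ℚ Q.≤ q Q.- p
p≤q⇒0≤q-p {p} {q} p≤q = subst (Q._≤ q Q.- p) (QP.+-inverseʳ p) (QP.+-monoˡ-≤ (Q.- p) p≤q)

p<q⇒0<q-p : ∀ {p q} → p Q.< q → 0ℚ Q.< q Q.- p
p<q⇒0<q-p {p} {q} p<q = subst (Q._< q Q.- p) (QP.+-inverseʳ p) (QP.+-monoˡ-< (Q.- p) p<q)

0<q-p⇒p<q : ∀ {p q} → 0ℚ Q.< q Q.- p → p Q.< q
0<q-p⇒p<q {p} {q} 0<q-p = subst₂ Q._<_ (QP.+-identityˡ p) (solve 2 (λ p q → (q :- p) :+ p := q) refl p q)
  (QP.+-monoˡ-< p 0<q-p)

0≤q⇒p≤p+q : ∀ p {q} → 0ℚ Q.≤ q → p Q.≤ p Q.+ q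
0≤q⇒p≤p+q p {q} 0≤q = subst (Q._≤ p Q.+ q) (QP.+-identityʳ p) (QP.+-monoʳ-≤ p 0≤q)

0<q⇒p<p+q : ∀ p {q} → 0ℚ Q.< q → p Q.< p Q.+ q
0<q⇒p<p+q p {q} 0<q = subst (Q._< p Q.+ q) (QP.+-identityʳ p) (QP.+-monoʳ-< p 0<q)

p≡q+r⇒p-r≡q : ∀ {p q r} → p ≡ q Q.+ r → p Q.- r ≡ q
p≡q+r⇒p-r≡q {q = q} {r} refl = solve 2 (λ q r → q :+ r :- r := q) refl q r

+-cancelʳ-< : ∀ {p q r} → p Q.+ r Q.< q Q.+ r → p Q.< q
+-cancelʳ-< {p} {q} {r} p+r<q+r =
  subst₂ Q._<_ (p≡q+r⇒p-r≡q refl) (p≡q+r⇒p-r≡q refl) (QP.+-monoˡ-< (Q.- r) p+r<q+r)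

0≤p⇒0≤q⇒0≤p*q : ∀ {p q} → 0ℚ Q.≤ p → 0ℚ Q.≤ q → 0ℚ Q.≤ p Q.* q
0≤p⇒0≤q⇒0≤p*q {p} {q} 0≤p 0≤q = QP.nonNegative⁻¹ (p Q.* q)
  {{QP.nonNeg*nonNeg⇒nonNeg p {{Q.nonNegative 0≤p}} q {{Q.nonNegative 0≤q}}}}

0<p⇒0<q⇒0<p*q : ∀ {p q} → 0ℚ Q.< p → 0ℚ Q.< q → 0ℚ Q.< p Q.* q
0<p⇒0<q⇒0<p*q {p} {q} 0<p 0<q = QP.positive⁻¹ (p Q.* q)
  {{QP.pos*pos⇒pos p {{Q.positive 0<p}} q {{Q.positive 0<q}}}}

1*u≡1⇒u≡1 : ∀ {x u} → x ≡ 1ℚ → x Q.* u ≡ 1ℚ → u ≡ 1ℚ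
1*u≡1⇒u≡1 {u = u} refl xu≡1 = trans (sym (QP.*-identityˡ u)) xu≡1

infixl 7 _÷_

-- m ÷ 0 = 0 is a junk value: the lemmas below all assume a positive denominator.
_÷_ : ℕ → ℕ → ℚ
m ÷ zero  = 0ℚ
m ÷ suc n = + m / suc n

toℚᵘ-÷ : ∀ a b → Q.toℚᵘ (a ÷ suc b) U.≃ U.mkℚᵘ (+ a) b
toℚᵘ-÷ a b = QP.toℚᵘ-fromℚᵘ (U.mkℚᵘ (+ a) b)

÷-cong : ∀ a B c D → 1 ≤ B → 1 ≤ D → a * D ≡ c * B → a ÷ B ≡ c ÷ D
÷-cong a (suc b) c (suc d) _ _ ad≡cb = QP.toℚᵘ-injective
  (UP.≃-trans (toℚᵘ-÷ a b) (UP.≃-trans (U.*≡* cross) (UP.≃-sym (toℚᵘ-÷ c d))))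
  where
  cross : + a ℤ.* + suc d ≡ + c ℤ.* + suc b
  cross = trans (sym (ℤP.pos-* a (suc d))) (trans (cong +_ ad≡cb) (ℤP.pos-* c (suc b)))

÷-≤ : ∀ a B c D → 1 ≤ B → 1 ≤ D → a * D ≤ c * B → a ÷ B Q.≤ c ÷ D
÷-≤ a (suc b) c (suc d) _ _ ad≤cb = QP.toℚᵘ-cancel-≤
  (UP.≤-respˡ-≃ (UP.≃-sym (toℚᵘ-÷ a b)) (UP.≤-respʳ-≃ (UP.≃-sym (toℚᵘ-÷ c d)) (U.*≤* cross)))
  where
  cross : + a ℤ.* + suc d ℤ.≤ + c ℤ.* + suc b
  cross = subst₂ ℤ._≤_ (ℤP.pos-* a (suc d)) (ℤP.pos-* c (suc b)) (ℤ.+≤+ ad≤cb)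

÷-≤⁻¹ : ∀ a B c D → 1 ≤ B → 1 ≤ D → a ÷ B Q.≤ c ÷ D → a * D ≤ c * B
÷-≤⁻¹ a (suc b) c (suc d) _ _ h
  with UP.≤-respˡ-≃ (toℚᵘ-÷ a b) (UP.≤-respʳ-≃ (toℚᵘ-÷ c d) (QP.toℚᵘ-mono-≤ h))
... | U.*≤* cross with subst₂ ℤ._≤_ (sym (ℤP.pos-* a (suc d))) (sym (ℤP.pos-* c (suc b))) cross
...   | ℤ.+≤+ ad≤cb = ad≤cb

÷-< : ∀ a B c D → 1 ≤ B → 1 ≤ D → a * D < c * B → a ÷ B Q.< c ÷ D
÷-< a (suc b) c (suc d) _ _ ad<cb = QP.toℚᵘ-cancel-<
  (UP.<-respˡ-≃ (UP.≃-sym (toℚᵘ-÷ a b)) (UP.<-respʳ-≃ (UP.≃-sym (toℚᵘ-÷ c d)) (U.*<* cross)))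
  where
  cross : + a ℤ.* + suc d ℤ.< + c ℤ.* + suc b
  cross = subst₂ ℤ._<_ (ℤP.pos-* a (suc d)) (ℤP.pos-* c (suc b)) (ℤ.+<+ ad<cb)

÷-<⁻¹ : ∀ a B c D → 1 ≤ B → 1 ≤ D → a ÷ B Q.< c ÷ D → a * D < c * B
÷-<⁻¹ a (suc b) c (suc d) _ _ h
  with UP.<-respˡ-≃ (toℚᵘ-÷ a b) (UP.<-respʳ-≃ (toℚᵘ-÷ c d) (QP.toℚᵘ-mono-< h))
... | U.*<* cross with subst₂ ℤ._<_ (sym (ℤP.pos-* a (suc d))) (sym (ℤP.pos-* c (suc b))) cross
...   | ℤ.+<+ ad<cb = ad<cb

÷-+ : ∀ a B c D → 1 ≤ B → 1 ≤ D → a ÷ B Q.+ c ÷ D ≡ (a * D + c * B) ÷ (B * D)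
÷-+ a (suc b) c (suc d) _ _ = QP.toℚᵘ-injective (UP.≃-trans (QP.toℚᵘ-homo-+ (a ÷ suc b) (c ÷ suc d))
  (UP.≃-trans (UP.+-cong (toℚᵘ-÷ a b) (toℚᵘ-÷ c d))
    (UP.≃-trans (U.*≡* cross) (UP.≃-sym (toℚᵘ-÷ (a * suc d + c * suc b) (d + b * suc d))))))
  where
  numerator : + a ℤ.* + suc d ℤ.+ + c ℤ.* + suc b ≡ + (a * suc d + c * suc b)
  numerator = trans (cong₂ ℤ._+_ (sym (ℤP.pos-* a (suc d))) (sym (ℤP.pos-* c (suc b))))
                    (sym (ℤP.pos-+ (a * suc d) (c * suc b)))
  cross : (+ a ℤ.* + suc d ℤ.+ + c ℤ.* + suc b) ℤ.* + suc (d + b * suc d)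
        ≡ + (a * suc d + c * suc b) ℤ.* + suc (d + b * suc d)
  cross = cong (ℤ._* + suc (d + b * suc d)) numerator

÷-* : ∀ a B c D → 1 ≤ B → 1 ≤ D → (a ÷ B) Q.* (c ÷ D) ≡ (a * c) ÷ (B * D)
÷-* a (suc b) c (suc d) _ _ = QP.toℚᵘ-injective (UP.≃-trans (QP.toℚᵘ-homo-* (a ÷ suc b) (c ÷ suc d))
  (UP.≃-trans (UP.*-cong (toℚᵘ-÷ a b) (toℚᵘ-÷ c d))
    (UP.≃-trans (U.*≡* cross) (UP.≃-sym (toℚᵘ-÷ (a * c) (d + b * suc d))))))
  where
  cross : (+ a ℤ.* + c) ℤ.* + suc (d + b * suc d) ≡ + (a * c) ℤ.* + suc (d + b * suc d)
  cross = cong (ℤ._* + suc (d + b * suc d)) (sym (ℤP.pos-* a c))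

÷-pos : ∀ a B → 1 ≤ a → 1 ≤ B → 0ℚ Q.< a ÷ B
÷-pos a B 1≤a 1≤B = ÷-< 0 1 a B (s≤s z≤n) 1≤B (subst (1 ≤_) (sym (ℕP.*-identityʳ a)) 1≤a)

÷≡1⇒≡ : ∀ a B → 1 ≤ B → a ÷ B ≡ 1ℚ → a ≡ B
÷≡1⇒≡ a B 1≤B a÷B≡1 = ℕP.≤-antisym
  (subst₂ _≤_ (ℕP.*-identityʳ a) (ℕP.*-identityˡ B) (÷-≤⁻¹ a B 1 1 1≤B (s≤s z≤n) (QP.≤-reflexive a÷B≡1)))
  (subst₂ _≤_ (ℕP.*-identityˡ B) (ℕP.*-identityʳ a) (÷-≤⁻¹ 1 1 a B (s≤s z≤n) 1≤B (QP.≤-reflexive (sym a÷B≡1))))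

inv≡1÷ : ∀ m → inv m ≡ 1 ÷ m
inv≡1÷ zero    = refl
inv≡1÷ (suc m) = refl

-- AM-GM and its weighted form

sumℚ : (ℕ → ℚ) → ℕ → ℚ
sumℚ f zero    = 0ℚ
sumℚ f (suc n) = sumℚ f n Q.+ f (suc n)

prodℚ : (ℕ → ℚ) → ℕ → ℚ
prodℚ f zero    = 1ℚ
prodℚ f (suc n) = prodℚ f n Q.* f (suc n)

sumℚ-cong : ∀ {f g} n → Upto n (λ i → f i ≡ g i) → sumℚ f n ≡ sumℚ g n
sumℚ-cong zero    _   = refl
sumℚ-cong (suc n) f≡g = cong₂ Q._+_ (sumℚ-cong n (upto-init f≡g)) (upto-last f≡g)

prodℚ-cong : ∀ {f g} n → Upto n (λ i → f i ≡ g i) → prodℚ f n ≡ prodℚ g n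
prodℚ-cong zero    _   = refl
prodℚ-cong (suc n) f≡g = cong₂ Q._*_ (prodℚ-cong n (upto-init f≡g)) (upto-last f≡g)

sumℚ-mono-≤ : ∀ {f g} n → Upto n (λ i → f i Q.≤ g i) → sumℚ f n Q.≤ sumℚ g n
sumℚ-mono-≤ zero    _   = QP.≤-refl
sumℚ-mono-≤ (suc n) f≤g = QP.+-mono-≤ (sumℚ-mono-≤ n (upto-init f≤g)) (upto-last f≤g)

sumℚ-- : ∀ (f g : ℕ → ℚ) n → sumℚ (λ i → f i Q.- g i) n ≡ sumℚ f n Q.- sumℚ g n
sumℚ-- f g zero    = refl
sumℚ-- f g (suc n) = trans (cong (Q._+ (f (suc n) Q.- g (suc n))) (sumℚ-- f g n))
  (solve 4 (λ a b c d → (a :- b) :+ (c :- d) := (a :+ c) :- (b :+ d)) refl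
    (sumℚ f n) (sumℚ g n) (f (suc n)) (g (suc n)))

prodℚ-≤1 : ∀ t n → Upto n (λ i → 0ℚ Q.≤ t i) → Upto n (λ i → t i Q.≤ 1ℚ) →
  0ℚ Q.≤ prodℚ t n × prodℚ t n Q.≤ 1ℚ
prodℚ-≤1 t zero    _   _   = QP.nonNegative⁻¹ 1ℚ , QP.≤-refl
prodℚ-≤1 t (suc n) 0≤t t≤1 with prodℚ-≤1 t n (upto-init 0≤t) (upto-init t≤1)
... | 0≤Π , Π≤1 = 0≤p⇒0≤q⇒0≤p*q 0≤Π (upto-last 0≤t) ,
  QP.≤-trans (QP.*-monoˡ-≤-nonNeg (prodℚ t n) {{Q.nonNegative 0≤Π}} (upto-last t≤1))
             (subst (Q._≤ 1ℚ) (sym (QP.*-identityʳ (prodℚ t n))) Π≤1)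

update : (ℕ → ℚ) → ℕ → ℚ → ℕ → ℚ
update t i v j with j ℕ.≟ i
... | yes _ = v
... | no  _ = t j

update-≡ : ∀ t i v → update t i v i ≡ v
update-≡ t i v with i ℕ.≟ i
... | yes _   = refl
... | no  i≢i = ⊥-elim (i≢i refl)

update-≢ : ∀ t i v j → j ≢ i → update t i v j ≡ t j
update-≢ t i v j j≢i with j ℕ.≟ i
... | yes j≡i = ⊥-elim (j≢i j≡i)
... | no  _   = refl

update-preserves : ∀ (R : ℚ → Set) t i v n → Upto n (λ j → R (t j)) → R v → Upto n (λ j → R (update t i v j))
update-preserves R t i v n Rt Rv j 1≤j j≤n with j ℕ.≟ i
... | yes _ = Rv
... | no  _ = Rt j 1≤j j≤n

update-beyond : ∀ t i v n → n < i → Upto n (λ j → update t i v j ≡ t j)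
update-beyond t i v n n<i j _ j≤n = update-≢ t i v j (λ { refl → ℕP.<⇒≱ n<i j≤n })

sumℚ-update : ∀ t i v n → 1 ≤ i → i ≤ n → sumℚ (update t i v) n Q.+ t i ≡ sumℚ t n Q.+ v
sumℚ-update t i v zero    1≤i i≤0 = ⊥-elim (ℕP.<⇒≱ 1≤i i≤0)
sumℚ-update t i v (suc n) 1≤i i≤1+n with suc n ℕ.≟ i
... | yes refl = begin
  sumℚ (update t (suc n) v) n Q.+ v Q.+ t (suc n)
    ≡⟨ cong (λ s → s Q.+ v Q.+ t (suc n)) (sumℚ-cong n (update-beyond t (suc n) v n ℕP.≤-refl)) ⟩
  sumℚ t n Q.+ v Q.+ t (suc n)
    ≡⟨ solve 3 (λ s v x → s :+ v :+ x := s :+ x :+ v) refl (sumℚ t n) v (t (suc n)) ⟩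
  sumℚ t n Q.+ t (suc n) Q.+ v ∎
  where open ≡-Reasoning
... | no 1+n≢i = begin
  sumℚ (update t i v) n Q.+ t (suc n) Q.+ t i
    ≡⟨ solve 3 (λ s x y → s :+ x :+ y := s :+ y :+ x) refl (sumℚ (update t i v) n) (t (suc n)) (t i) ⟩
  sumℚ (update t i v) n Q.+ t i Q.+ t (suc n)
    ≡⟨ cong (Q._+ t (suc n)) (sumℚ-update t i v n 1≤i (ℕP.≤-pred (ℕP.≤∧≢⇒< i≤1+n (1+n≢i ∘ sym)))) ⟩
  sumℚ t n Q.+ v Q.+ t (suc n)
    ≡⟨ solve 3 (λ s v x → s :+ v :+ x := s :+ x :+ v) refl (sumℚ t n) v (t (suc n)) ⟩
  sumℚ t n Q.+ t (suc n) Q.+ v ∎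
  where open ≡-Reasoning

prodℚ-update : ∀ t i u n → 1 ≤ i → i ≤ n → prodℚ (update t i (t i Q.* u)) n ≡ prodℚ t n Q.* u
prodℚ-update t i u zero    1≤i i≤0 = ⊥-elim (ℕP.<⇒≱ 1≤i i≤0)
prodℚ-update t i u (suc n) 1≤i i≤1+n with suc n ℕ.≟ i
... | yes refl = begin
  prodℚ (update t (suc n) (t (suc n) Q.* u)) n Q.* (t (suc n) Q.* u)
    ≡⟨ cong (Q._* (t (suc n) Q.* u)) (prodℚ-cong n (update-beyond t (suc n) _ n ℕP.≤-refl)) ⟩
  prodℚ t n Q.* (t (suc n) Q.* u)
    ≡⟨ QP.*-assoc (prodℚ t n) (t (suc n)) u ⟨
  prodℚ t n Q.* t (suc n) Q.* u ∎
  where open ≡-Reasoning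
... | no 1+n≢i = begin
  prodℚ (update t i (t i Q.* u)) n Q.* t (suc n)
    ≡⟨ cong (Q._* t (suc n)) (prodℚ-update t i u n 1≤i (ℕP.≤-pred (ℕP.≤∧≢⇒< i≤1+n (1+n≢i ∘ sym)))) ⟩
  prodℚ t n Q.* u Q.* t (suc n)
    ≡⟨ solve 3 (λ s u x → s :* u :* x := s :* x :* u) refl (prodℚ t n) u (t (suc n)) ⟩
  prodℚ t n Q.* t (suc n) Q.* u ∎
  where open ≡-Reasoning

SumAboveOrAllOne : ℕ → (ℕ → ℚ) → Set
SumAboveOrAllOne n t = sumℚ (const 1ℚ) n Q.< sumℚ t n ⊎ Upto n (λ i → t i ≡ 1ℚ)

sumℚ-merge : ∀ t i u n → 1 ≤ i → i ≤ n →
  sumℚ t n Q.+ u ≡ sumℚ (update t i (t i Q.* u)) n Q.+ 1ℚ Q.+ (u Q.- 1ℚ) Q.* (1ℚ Q.- t i)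
sumℚ-merge t i u n 1≤i i≤n = begin
  sumℚ t n Q.+ u
    ≡⟨ solve 3 (λ s x u → s :+ u := s :+ x :* u :- x :* u :+ u) refl (sumℚ t n) (t i) u ⟩
  sumℚ t n Q.+ t i Q.* u Q.- t i Q.* u Q.+ u
    ≡⟨ cong (λ s → s Q.- t i Q.* u Q.+ u) (sumℚ-update t i (t i Q.* u) n 1≤i i≤n) ⟨
  S′ Q.+ t i Q.- t i Q.* u Q.+ u
    ≡⟨ solve 3 (λ s x u → s :+ x :- x :* u :+ u := s :+ con 1ℚ :+ (u :- con 1ℚ) :* (con 1ℚ :- x)) refl S′ (t i) u ⟩
  S′ Q.+ 1ℚ Q.+ (u Q.- 1ℚ) Q.* (1ℚ Q.- t i) ∎
  where
  open ≡-Reasoning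
  S′ = sumℚ (update t i (t i Q.* u)) n

-- Merging the factors tᵢ and u = tₙ₊₁ into tᵢ u keeps the product and lowers the sum by
-- 1 + (u - 1)(1 - tᵢ), which is at least 1 when tᵢ and u lie on opposite sides of 1.
am-gm-merge : ∀ n t i → 1 ≤ i → i ≤ n →
  (∀ t′ → Upto n (λ j → 0ℚ Q.< t′ j) → 1ℚ Q.≤ prodℚ t′ n → SumAboveOrAllOne n t′) →
  Upto (suc n) (λ j → 0ℚ Q.< t j) → 1ℚ Q.≤ prodℚ t (suc n) →
  0ℚ Q.≤ (t (suc n) Q.- 1ℚ) Q.* (1ℚ Q.- t i) →
  (t i Q.* t (suc n) ≡ 1ℚ → 0ℚ Q.< (t (suc n) Q.- 1ℚ) Q.* (1ℚ Q.- t i)) →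
  sumℚ (const 1ℚ) (suc n) Q.< sumℚ t (suc n)
am-gm-merge n t i 1≤i i≤n am-gm-n 0<t 1≤Π 0≤D 0<D
  with am-gm-n t′ (update-preserves (0ℚ Q.<_) t i (t i Q.* u) n (upto-init 0<t) 0<tᵢu)
                  (subst (1ℚ Q.≤_) (sym (prodℚ-update t i u n 1≤i i≤n)) 1≤Π)
  where
  u = t (suc n)
  t′ = update t i (t i Q.* u)
  0<tᵢu : 0ℚ Q.< t i Q.* u
  0<tᵢu = 0<p⇒0<q⇒0<p*q (upto-init 0<t i 1≤i i≤n) (upto-last 0<t)
... | inj₁ n<S′ = QP.<-≤-trans (QP.+-monoˡ-< 1ℚ n<S′)
  (QP.≤-trans (0≤q⇒p≤p+q _ 0≤D) (QP.≤-reflexive (sym (sumℚ-merge t i (t (suc n)) n 1≤i i≤n))))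
... | inj₂ ones = subst₂ Q._<_ (cong (Q._+ 1ℚ) (sumℚ-cong n ones)) (sym (sumℚ-merge t i (t (suc n)) n 1≤i i≤n))
  (0<q⇒p<p+q _ (0<D (trans (sym (update-≡ t i (t i Q.* t (suc n)))) (ones i 1≤i i≤n))))

am-gm : ∀ n t → Upto n (λ i → 0ℚ Q.< t i) → 1ℚ Q.≤ prodℚ t n → SumAboveOrAllOne n t
am-gm zero    t _   _   = inj₂ upto-zero
am-gm (suc n) t 0<t 1≤Π with QP.<-cmp (t (suc n)) 1ℚ
... | tri≈ _ u≡1 _
  with am-gm n t (upto-init 0<t) (subst (1ℚ Q.≤_) (trans (cong (prodℚ t n Q.*_) u≡1) (QP.*-identityʳ _)) 1≤Π)
...   | inj₁ n<S  = inj₁ (QP.+-mono-<-≤ n<S (QP.≤-reflexive (sym u≡1)))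
...   | inj₂ ones = inj₂ (upto-snoc ones u≡1)
am-gm (suc n) t 0<t 1≤Π | tri> _ _ u>1 with search (λ i → t i QP.≤? 1ℚ) n
...   | inj₂ all>1 = inj₁ (QP.+-mono-≤-< (sumℚ-mono-≤ n (λ i 1≤i i≤n → QP.<⇒≤ (QP.≰⇒> (all>1 i 1≤i i≤n)))) u>1)
...   | inj₁ (i , 1≤i , i≤n , tᵢ≤1) = inj₁ (am-gm-merge n t i 1≤i i≤n (am-gm n) 0<t 1≤Π
  (0≤p⇒0≤q⇒0≤p*q (QP.<⇒≤ (p<q⇒0<q-p u>1)) (p≤q⇒0≤q-p tᵢ≤1)) 0<D)
  where
  0<D : t i Q.* t (suc n) ≡ 1ℚ → 0ℚ Q.< (t (suc n) Q.- 1ℚ) Q.* (1ℚ Q.- t i)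
  0<D tᵢu≡1 with QP.<-cmp (t i) 1ℚ
  ... | tri< tᵢ<1 _ _ = 0<p⇒0<q⇒0<p*q (p<q⇒0<q-p u>1) (p<q⇒0<q-p tᵢ<1)
  ... | tri≈ _ tᵢ≡1 _ = ⊥-elim (QP.<-irrefl (sym (1*u≡1⇒u≡1 tᵢ≡1 tᵢu≡1)) u>1)
  ... | tri> _ _ tᵢ>1 = ⊥-elim (QP.<-irrefl refl (QP.<-≤-trans tᵢ>1 tᵢ≤1))
am-gm (suc n) t 0<t 1≤Π | tri< u<1 _ _ with search (λ i → 1ℚ QP.≤? t i) n
...   | inj₂ all<1 = ⊥-elim (QP.<-irrefl refl (QP.≤-<-trans 1≤Π (QP.≤-<-trans Πu≤u u<1)))
  where
  0≤Π×Π≤1 = prodℚ-≤1 t n (λ i 1≤i i≤n → QP.<⇒≤ (upto-init 0<t i 1≤i i≤n))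
                         (λ i 1≤i i≤n → QP.<⇒≤ (QP.≰⇒> (all<1 i 1≤i i≤n)))
  Πu≤u : prodℚ t n Q.* t (suc n) Q.≤ t (suc n)
  Πu≤u = subst (prodℚ t n Q.* t (suc n) Q.≤_) (QP.*-identityˡ (t (suc n)))
    (QP.*-monoʳ-≤-nonNeg (t (suc n)) {{Q.nonNegative (QP.<⇒≤ (upto-last 0<t))}} (proj₂ 0≤Π×Π≤1))
...   | inj₁ (i , 1≤i , i≤n , 1≤tᵢ) = inj₁ (am-gm-merge n t i 1≤i i≤n (am-gm n) 0<t 1≤Π
  (subst (0ℚ Q.≤_) (flip (t (suc n)) (t i)) (0≤p⇒0≤q⇒0≤p*q (p≤q⇒0≤q-p (QP.<⇒≤ u<1)) (p≤q⇒0≤q-p 1≤tᵢ))) 0<D)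
  where
  flip : ∀ u x → (1ℚ Q.- u) Q.* (x Q.- 1ℚ) ≡ (u Q.- 1ℚ) Q.* (1ℚ Q.- x)
  flip = solve 2 (λ u x → (con 1ℚ :- u) :* (x :- con 1ℚ) := (u :- con 1ℚ) :* (con 1ℚ :- x)) refl
  0<D : t i Q.* t (suc n) ≡ 1ℚ → 0ℚ Q.< (t (suc n) Q.- 1ℚ) Q.* (1ℚ Q.- t i)
  0<D tᵢu≡1 with QP.<-cmp (t i) 1ℚ
  ... | tri> _ _ tᵢ>1 = subst (0ℚ Q.<_) (flip (t (suc n)) (t i)) (0<p⇒0<q⇒0<p*q (p<q⇒0<q-p u<1) (p<q⇒0<q-p tᵢ>1))
  ... | tri≈ _ tᵢ≡1 _ = ⊥-elim (QP.<-irrefl (1*u≡1⇒u≡1 tᵢ≡1 tᵢu≡1) u<1)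
  ... | tri< tᵢ<1 _ _ = ⊥-elim (QP.<-irrefl refl (QP.<-≤-trans tᵢ<1 1≤tᵢ))

sumℚ-shift-weight : ∀ (w f : ℕ → ℚ) c n →
  sumℚ (λ i → w i Q.* f i) n ≡ sumℚ (λ i → (w i Q.- c) Q.* f i) n Q.+ c Q.* sumℚ f n
sumℚ-shift-weight w f c zero    = solve 1 (λ c → con 0ℚ := con 0ℚ :+ c :* con 0ℚ) refl c
sumℚ-shift-weight w f c (suc n) = begin
  sumℚ (λ i → w i Q.* f i) n Q.+ w (suc n) Q.* f (suc n)
    ≡⟨ cong (Q._+ w (suc n) Q.* f (suc n)) (sumℚ-shift-weight w f c n) ⟩
  R Q.+ c Q.* sumℚ f n Q.+ w (suc n) Q.* f (suc n)
    ≡⟨ solve 5 (λ R c S w x → R :+ c :* S :+ w :* x := R :+ (w :- c) :* x :+ c :* (S :+ x)) refl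
         R c (sumℚ f n) (w (suc n)) (f (suc n)) ⟩
  R Q.+ (w (suc n) Q.- c) Q.* f (suc n) Q.+ c Q.* sumℚ f (suc n) ∎
  where
  open ≡-Reasoning
  R = sumℚ (λ i → (w i Q.- c) Q.* f i) n

sumℚ-peel-weight : ∀ (w f : ℕ → ℚ) n →
  sumℚ (λ i → w i Q.* f i) (suc n) ≡ sumℚ (λ i → (w i Q.- w (suc n)) Q.* f i) n Q.+ w (suc n) Q.* sumℚ f (suc n)
sumℚ-peel-weight w f n = trans (sumℚ-shift-weight w f (w (suc n)) (suc n))
  (cong (Q._+ w (suc n) Q.* sumℚ f (suc n))
    (solve 3 (λ R c x → R :+ (c :- c) :* x := R) refl
      (sumℚ (λ i → (w i Q.- w (suc n)) Q.* f i) n) (w (suc n)) (f (suc n))))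

lowered-weights : ∀ n w → Upto (suc n) (λ i → 0ℚ Q.≤ w i) → ChainUpto Q._≥_ (suc n) w →
  Upto n (λ i → 0ℚ Q.≤ w i Q.- w (suc n)) × ChainUpto Q._≥_ n (λ i → w i Q.- w (suc n))
lowered-weights n w 0≤w w↓ =
  (λ i 1≤i i≤n → p≤q⇒0≤q-p (chainUpto⇒related Q._≥_ QP.≤-refl (λ x≥y y≥z → QP.≤-trans y≥z x≥y)
    (suc n) w w↓ i (suc n) 1≤i (ℕP.m≤n⇒m≤1+n i≤n) ℕP.≤-refl)) ,
  (λ i 1≤i i<n → QP.+-monoˡ-≤ (Q.- w (suc n)) (w↓ i 1≤i (ℕP.m≤n⇒m≤1+n i<n)))

weighted-am-gm : ∀ n t w → Upto n (λ i → 0ℚ Q.< t i) → Upto n (λ k → 1ℚ Q.≤ prodℚ t k) →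
  Upto n (λ i → 0ℚ Q.≤ w i) → ChainUpto Q._≥_ n w → 0ℚ Q.≤ sumℚ (λ i → w i Q.* (t i Q.- 1ℚ)) n
weighted-am-gm zero    t w _   _    _   _  = QP.≤-refl
weighted-am-gm (suc n) t w 0<t 1≤Πt 0≤w w↓ = subst (0ℚ Q.≤_) (sym (sumℚ-peel-weight w (λ i → t i Q.- 1ℚ) n))
  (QP.+-mono-≤ (weighted-am-gm n t (λ i → w i Q.- w (suc n)) (upto-init 0<t) (upto-init 1≤Πt) 0≤w′ w′↓)
               (0≤p⇒0≤q⇒0≤p*q (upto-last 0≤w)
                 (subst (0ℚ Q.≤_) (sym (sumℚ-- t (const 1ℚ) (suc n))) (p≤q⇒0≤q-p n≤Σt))))
  where
  0≤w′ = proj₁ (lowered-weights n w 0≤w w↓)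
  w′↓ = proj₂ (lowered-weights n w 0≤w w↓)
  n≤Σt : sumℚ (const 1ℚ) (suc n) Q.≤ sumℚ t (suc n)
  n≤Σt with am-gm (suc n) t 0<t (upto-last 1≤Πt)
  ... | inj₁ n<Σt = QP.<⇒≤ n<Σt
  ... | inj₂ ones = QP.≤-reflexive (sumℚ-cong (suc n) (λ i 1≤i i≤n → sym (ones i 1≤i i≤n)))

weighted-am-gm-strict : ∀ n t w → Upto (suc n) (λ i → 0ℚ Q.< t i) → Upto (suc n) (λ k → 1ℚ Q.≤ prodℚ t k) →
  Upto (suc n) (λ i → 0ℚ Q.≤ w i) → ChainUpto Q._≥_ (suc n) w → 0ℚ Q.< w (suc n) →
  0ℚ Q.< sumℚ (λ i → w i Q.* (t i Q.- 1ℚ)) (suc n) ⊎ Upto (suc n) (λ i → t i ≡ 1ℚ)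
weighted-am-gm-strict n t w 0<t 1≤Πt 0≤w w↓ 0<wₙ with am-gm (suc n) t 0<t (upto-last 1≤Πt)
... | inj₂ ones = inj₂ ones
... | inj₁ n<Σt = inj₁ (subst (0ℚ Q.<_) (sym (sumℚ-peel-weight w (λ i → t i Q.- 1ℚ) n))
  (QP.+-mono-≤-< (weighted-am-gm n t (λ i → w i Q.- w (suc n)) (upto-init 0<t) (upto-init 1≤Πt) 0≤w′ w′↓)
                 (0<p⇒0<q⇒0<p*q 0<wₙ (subst (0ℚ Q.<_) (sym (sumℚ-- t (const 1ℚ) (suc n))) (p<q⇒0<q-p n<Σt)))))
  where
  0≤w′ = proj₁ (lowered-weights n w 0≤w w↓)
  w′↓ = proj₂ (lowered-weights n w 0≤w w↓)

-- Sums of unit fractions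

prodℕ : (ℕ → ℕ) → ℕ → ℕ
prodℕ f zero    = 1
prodℕ f (suc n) = prodℕ f n * f (suc n)

prodℕ-pos : ∀ f n → Upto n (λ i → 1 ≤ f i) → 1 ≤ prodℕ f n
prodℕ-pos f zero    _     = s≤s z≤n
prodℕ-pos f (suc n) 1≤f = ℕP.*-mono-≤ (prodℕ-pos f n (upto-init 1≤f)) (upto-last 1≤f)

prodℕ-+ : ∀ f m k → prodℕ f (m + k) ≡ prodℕ f m * prodℕ (λ i → f (m + i)) k
prodℕ-+ f m zero    = trans (cong (prodℕ f) (ℕP.+-identityʳ m)) (sym (ℕP.*-identityʳ (prodℕ f m)))
prodℕ-+ f m (suc k) = begin
  prodℕ f (m + suc k)
    ≡⟨ cong (prodℕ f) (ℕP.+-suc m k) ⟩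
  prodℕ f (m + k) * f (suc (m + k))
    ≡⟨ cong₂ _*_ (prodℕ-+ f m k) (cong f (sym (ℕP.+-suc m k))) ⟩
  prodℕ f m * prodℕ (λ i → f (m + i)) k * f (m + suc k)
    ≡⟨ ℕP.*-assoc (prodℕ f m) _ _ ⟩
  prodℕ f m * prodℕ (λ i → f (m + i)) (suc k) ∎
  where open ≡-Reasoning

prodℚ-÷ : ∀ x a n → Upto n (λ i → 1 ≤ a i) → prodℚ (λ i → x i ÷ a i) n ≡ prodℕ x n ÷ prodℕ a n
prodℚ-÷ x a zero    _   = refl
prodℚ-÷ x a (suc n) 1≤a = trans (cong (Q._* (x (suc n) ÷ a (suc n))) (prodℚ-÷ x a n (upto-init 1≤a)))
  (÷-* (prodℕ x n) (prodℕ a n) (x (suc n)) (a (suc n)) (prodℕ-pos a n (upto-init 1≤a)) (upto-last 1≤a))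

partialSum≡sumℚ : ∀ f n → partialSum f n ≡ sumℚ (λ i → inv (f i)) n
partialSum≡sumℚ f zero    = refl
partialSum≡sumℚ f (suc n) = cong (Q._+ inv (f (suc n))) (partialSum≡sumℚ f n)

partialSum-cong : ∀ f g n → Upto n (λ i → f i ≡ g i) → partialSum f n ≡ partialSum g n
partialSum-cong f g zero    _   = refl
partialSum-cong f g (suc n) f≡g = cong₂ Q._+_ (partialSum-cong f g n (upto-init f≡g)) (cong inv (upto-last f≡g))

partialSum-+ : ∀ f m k → partialSum f (m + k) ≡ partialSum f m Q.+ partialSum (λ i → f (m + i)) k
partialSum-+ f m zero    = trans (cong (partialSum f) (ℕP.+-identityʳ m)) (sym (QP.+-identityʳ (partialSum f m)))
partialSum-+ f m (suc k) = begin
  partialSum f (m + suc k)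
    ≡⟨ cong (partialSum f) (ℕP.+-suc m k) ⟩
  partialSum f (m + k) Q.+ inv (f (suc (m + k)))
    ≡⟨ cong₂ Q._+_ (partialSum-+ f m k) (cong (λ j → inv (f j)) (sym (ℕP.+-suc m k))) ⟩
  partialSum f m Q.+ partialSum (λ i → f (m + i)) k Q.+ inv (f (m + suc k))
    ≡⟨ QP.+-assoc (partialSum f m) _ _ ⟩
  partialSum f m Q.+ partialSum (λ i → f (m + i)) (suc k) ∎
  where open ≡-Reasoning

inv-nonNeg : ∀ m → 0ℚ Q.≤ inv m
inv-nonNeg zero    = QP.≤-refl
inv-nonNeg (suc m) = QP.<⇒≤ (÷-pos 1 (suc m) (s≤s z≤n) (s≤s z≤n))

partialSum-nonNeg : ∀ f n → 0ℚ Q.≤ partialSum f n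
partialSum-nonNeg f zero    = QP.≤-refl
partialSum-nonNeg f (suc n) = QP.+-mono-≤ (partialSum-nonNeg f n) (inv-nonNeg (f (suc n)))

partialSum-mono : ∀ f {m n} → m ≤ n → partialSum f m Q.≤ partialSum f n
partialSum-mono f {m} {n} m≤n = begin
  partialSum f m
    ≤⟨ 0≤q⇒p≤p+q (partialSum f m) (partialSum-nonNeg (λ i → f (m + i)) (n ∸ m)) ⟩
  partialSum f m Q.+ partialSum (λ i → f (m + i)) (n ∸ m)
    ≡⟨ partialSum-+ f m (n ∸ m) ⟨
  partialSum f (m + (n ∸ m))
    ≡⟨ cong (partialSum f) (ℕP.m+[n∸m]≡n m≤n) ⟩
  partialSum f n ∎
  where open QP.≤-Reasoning

partialSum-÷ : ∀ f n → Upto n (λ i → 1 ≤ f i) → ∃[ N ] partialSum f n ≡ N ÷ prodℕ f n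
partialSum-÷ f zero    _   = 0 , refl
partialSum-÷ f (suc n) 1≤f with partialSum-÷ f n (upto-init 1≤f)
... | N , Σ≡N÷P = N * f (suc n) + prodℕ f n , (begin
  partialSum f n Q.+ inv (f (suc n))
    ≡⟨ cong₂ Q._+_ Σ≡N÷P (inv≡1÷ (f (suc n))) ⟩
  N ÷ prodℕ f n Q.+ 1 ÷ f (suc n)
    ≡⟨ ÷-+ N (prodℕ f n) 1 (f (suc n)) (prodℕ-pos f n (upto-init 1≤f)) (upto-last 1≤f) ⟩
  (N * f (suc n) + 1 * prodℕ f n) ÷ prodℕ f (suc n)
    ≡⟨ cong (λ m → (N * f (suc n) + m) ÷ prodℕ f (suc n)) (ℕP.*-identityˡ (prodℕ f n)) ⟩
  (N * f (suc n) + prodℕ f n) ÷ prodℕ f (suc n) ∎)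
  where open ≡-Reasoning

1÷x*[x÷a-1] : ∀ x a → 1 ≤ x → 1 ≤ a → 1 ÷ x Q.* (x ÷ a Q.- 1ℚ) ≡ inv a Q.- inv x
1÷x*[x÷a-1] x a 1≤x 1≤a = begin
  1 ÷ x Q.* (x ÷ a Q.- 1ℚ)
    ≡⟨ solve 2 (λ w t → w :* (t :- con 1ℚ) := w :* t :- w) refl (1 ÷ x) (x ÷ a) ⟩
  1 ÷ x Q.* (x ÷ a) Q.- 1 ÷ x
    ≡⟨ cong (Q._- 1 ÷ x) (÷-* 1 x x a 1≤x 1≤a) ⟩
  (1 * x) ÷ (x * a) Q.- 1 ÷ x
    ≡⟨ cong (Q._- 1 ÷ x) (÷-cong (1 * x) (x * a) 1 a (ℕP.*-mono-≤ 1≤x 1≤a) 1≤a (ℕP.*-assoc 1 x a)) ⟩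
  1 ÷ a Q.- 1 ÷ x
    ≡⟨ cong₂ Q._-_ (inv≡1÷ a) (inv≡1÷ x) ⟨
  inv a Q.- inv x ∎
  where open ≡-Reasoning

partialSum-<-or-≡ : ∀ n x a → Upto (suc n) (λ i → 1 ≤ x i) → Upto (suc n) (λ i → 1 ≤ a i) →
  ChainUpto _≤_ (suc n) x → Upto (suc n) (λ k → prodℕ a k ≤ prodℕ x k) →
  partialSum x (suc n) Q.< partialSum a (suc n) ⊎ Upto (suc n) (λ i → x i ≡ a i)
partialSum-<-or-≡ n x a 1≤x 1≤a x↑ Πa≤Πx
  with weighted-am-gm-strict n (λ i → x i ÷ a i) (λ i → 1 ÷ x i) 0<t 1≤Πt 0≤w w↓
         (÷-pos 1 (x (suc n)) (s≤s z≤n) (upto-last 1≤x))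
  where
  0<t : Upto (suc n) (λ i → 0ℚ Q.< x i ÷ a i)
  0<t i 1≤i i≤n = ÷-pos (x i) (a i) (1≤x i 1≤i i≤n) (1≤a i 1≤i i≤n)
  1≤Πt : Upto (suc n) (λ k → 1ℚ Q.≤ prodℚ (λ i → x i ÷ a i) k)
  1≤Πt k 1≤k k≤n = subst (1ℚ Q.≤_) (sym (prodℚ-÷ x a k (upto-take k≤n 1≤a)))
    (÷-≤ 1 1 (prodℕ x k) (prodℕ a k) (s≤s z≤n) (prodℕ-pos a k (upto-take k≤n 1≤a))
      (subst₂ _≤_ (sym (ℕP.*-identityˡ (prodℕ a k))) (sym (ℕP.*-identityʳ (prodℕ x k))) (Πa≤Πx k 1≤k k≤n)))
  0≤w : Upto (suc n) (λ i → 0ℚ Q.≤ 1 ÷ x i)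
  0≤w i 1≤i i≤n = QP.<⇒≤ (÷-pos 1 (x i) (s≤s z≤n) (1≤x i 1≤i i≤n))
  w↓ : ChainUpto Q._≥_ (suc n) (λ i → 1 ÷ x i)
  w↓ i 1≤i i<n = ÷-≤ 1 (x (suc i)) 1 (x i) (1≤x (suc i) (s≤s z≤n) i<n) (1≤x i 1≤i (ℕP.<⇒≤ i<n))
    (subst₂ _≤_ (sym (ℕP.*-identityˡ (x i))) (sym (ℕP.*-identityˡ (x (suc i)))) (x↑ i 1≤i i<n))
... | inj₂ ones = inj₂ (λ i 1≤i i≤n → ÷≡1⇒≡ (x i) (a i) (1≤a i 1≤i i≤n) (ones i 1≤i i≤n))
... | inj₁ 0<Σ = inj₁ (0<q-p⇒p<q (subst (0ℚ Q.<_) Σ≡Σa-Σx 0<Σ))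
  where
  Σ≡Σa-Σx : sumℚ (λ i → 1 ÷ x i Q.* (x i ÷ a i Q.- 1ℚ)) (suc n) ≡ partialSum a (suc n) Q.- partialSum x (suc n)
  Σ≡Σa-Σx = begin
    sumℚ (λ i → 1 ÷ x i Q.* (x i ÷ a i Q.- 1ℚ)) (suc n)
      ≡⟨ sumℚ-cong (suc n) (λ i 1≤i i≤n → 1÷x*[x÷a-1] (x i) (a i) (1≤x i 1≤i i≤n) (1≤a i 1≤i i≤n)) ⟩
    sumℚ (λ i → inv (a i) Q.- inv (x i)) (suc n)
      ≡⟨ sumℚ-- (λ i → inv (a i)) (λ i → inv (x i)) (suc n) ⟩
    sumℚ (λ i → inv (a i)) (suc n) Q.- sumℚ (λ i → inv (x i)) (suc n)
      ≡⟨ cong₂ Q._-_ (partialSum≡sumℚ a (suc n)) (partialSum≡sumℚ x (suc n)) ⟨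
    partialSum a (suc n) Q.- partialSum x (suc n) ∎
    where open ≡-Reasoning

partialSum-≤ : ∀ n x a → Upto n (λ i → 1 ≤ x i) → Upto n (λ i → 1 ≤ a i) →
  ChainUpto _≤_ n x → Upto n (λ k → prodℕ a k ≤ prodℕ x k) → partialSum x n Q.≤ partialSum a n
partialSum-≤ zero    x a _   _   _  _      = QP.≤-refl
partialSum-≤ (suc n) x a 1≤x 1≤a x↑ Πa≤Πx with partialSum-<-or-≡ n x a 1≤x 1≤a x↑ Πa≤Πx
... | inj₁ Σx<Σa = QP.<⇒≤ Σx<Σa
... | inj₂ x≡a   = QP.≤-reflexive (partialSum-cong x a (suc n) x≡a)

partialSum-gap : ∀ x m p Q A → 1 ≤ Q → Upto m (λ i → 1 ≤ x i) → prodℕ x m < A →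
  partialSum x m Q.< p ÷ Q → partialSum x m Q.+ 1 ÷ (Q * A) Q.< p ÷ Q
partialSum-gap x m p Q A 1≤Q 1≤x D<A Σ<p÷Q with partialSum-÷ x m 1≤x
... | N , Σ≡N÷D = begin-strict
  partialSum x m Q.+ 1 ÷ (Q * A)   <⟨ QP.+-monoʳ-< (partialSum x m) 1÷QA<1÷QD ⟩
  partialSum x m Q.+ 1 ÷ (Q * D)   ≡⟨ cong (Q._+ 1 ÷ (Q * D)) Σ≡N÷D ⟩
  N ÷ D Q.+ 1 ÷ (Q * D)            ≡⟨ ÷-+ N D 1 (Q * D) 1≤D 1≤QD ⟩
  (N * (Q * D) + 1 * D) ÷ (D * (Q * D))
    ≤⟨ ÷-≤ _ (D * (Q * D)) p Q (ℕP.*-mono-≤ 1≤D 1≤QD) 1≤Q (subst₂ _≤_ (sym (lhs N Q D)) (sym (rhs p Q D))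
         (ℕP.*-monoˡ-≤ (D * Q) NQ<pD)) ⟩
  p ÷ Q ∎
  where
  open QP.≤-Reasoning
  D = prodℕ x m
  1≤D = prodℕ-pos x m 1≤x
  1≤QD = ℕP.*-mono-≤ 1≤Q 1≤D
  1÷QA<1÷QD : 1 ÷ (Q * A) Q.< 1 ÷ (Q * D)
  1÷QA<1÷QD = ÷-< 1 (Q * A) 1 (Q * D) (ℕP.*-mono-≤ 1≤Q (ℕP.≤-trans 1≤D (ℕP.<⇒≤ D<A))) 1≤QD
    (subst₂ _<_ (sym (ℕP.*-identityˡ (Q * D))) (sym (ℕP.*-identityˡ (Q * A)))
      (ℕP.*-monoʳ-< Q {{ℕ.>-nonZero 1≤Q}} D<A))
  NQ<pD : N * Q < p * D
  NQ<pD = ÷-<⁻¹ N D p Q 1≤D 1≤Q (subst (Q._< p ÷ Q) Σ≡N÷D Σ<p÷Q)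
  lhs : ∀ N Q D → (N * (Q * D) + 1 * D) * Q ≡ suc (N * Q) * (D * Q)
  lhs = solve-∀
  rhs : ∀ p Q D → p * (D * (Q * D)) ≡ p * D * (D * Q)
  rhs = solve-∀

-- The greedy expansion of p/q when p ∣ q + 1

/-unique : ∀ m n k .{{_ : NonZero n}} → k * n ≤ m → m < suc k * n → m ℕD./ n ≡ k
/-unique m n k kn≤m m<[1+k]n = ℕP.≤-antisym (ℕP.≤-pred (ℕD.m<n*o⇒m/o<n m<[1+k]n))
  (subst (_≤ m ℕD./ n) (ℕD.m*n/n≡m k n) (ℕD./-monoˡ-≤ n kn≤m))

∣1+n⇒coprime : ∀ {p n} → p ∣ suc n → Coprime p n
∣1+n⇒coprime {p} {n} p∣1+n {d} (d∣p , d∣n) = ∣1⇒≡1 (∣m+n∣m⇒∣n d∣n+1 d∣n)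
  where
  d∣n+1 : d ∣ n + 1
  d∣n+1 = subst (d ∣_) (ℕP.+-comm 1 n) (∣-trans d∣p p∣1+n)

1+n≡m*o⇒1≤m : ∀ {n} m {o} → suc n ≡ m * o → 1 ≤ m
1+n≡m*o⇒1≤m (suc _) _ = s≤s z≤n

G≥1 : ∀ θ → 1 ≤ G θ
G≥1 θ with ∣ ↥ θ ∣
... | zero  = s≤s z≤n
... | suc _ = s≤s z≤n

G-1÷ : ∀ M → 1 ≤ M → G (1 ÷ M) ≡ suc M
G-1÷ (suc m) _ = trans (cong G (QP.normalize-coprime {1} {m} (1-coprimeTo (suc m)))) (cong suc (ℕD.n/1≡n (suc m)))

1÷M-1÷[1+M] : ∀ M → 1 ≤ M → 1 ÷ M Q.- 1 ÷ suc M ≡ 1 ÷ (M * suc M)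
1÷M-1÷[1+M] M 1≤M = p≡q+r⇒p-r≡q (sym (trans
  (÷-+ 1 (M * suc M) 1 (suc M) 1≤M[1+M] (s≤s z≤n))
  (÷-cong _ (M * suc M * suc M) 1 M (ℕP.*-mono-≤ 1≤M[1+M] (s≤s z≤n)) 1≤M (identity M))))
  where
  1≤M[1+M] = ℕP.*-mono-≤ 1≤M (s≤s z≤n)
  identity : ∀ M → (1 * suc M + 1 * (M * suc M)) * M ≡ 1 * (M * suc M * suc M)
  identity = solve-∀

G-p÷q : ∀ p q c → 1 ≤ p → 1 ≤ q → suc q ≡ c * p → G (p ÷ q) ≡ c
G-p÷q p@(suc _) (suc q) (suc c) 1≤p _ 1+q≡cp = trans
  (cong G (QP.normalize-coprime {p} {q} (∣1+n⇒coprime (divides (suc c) 1+q≡cp))))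
  (cong suc (/-unique (suc q) p c cp≤1+q (subst (suc q <_) 1+q≡cp ℕP.≤-refl)))
  where
  cp≤1+q : c * p ≤ suc q
  cp≤1+q = ℕP.≤-pred (subst (suc (c * p) ≤_) (sym 1+q≡cp) (ℕP.+-monoˡ-≤ (c * p) 1≤p))

p÷q-1÷c : ∀ p q c → 1 ≤ q → 1 ≤ c → suc q ≡ c * p → p ÷ q Q.- 1 ÷ c ≡ 1 ÷ (q * c)
p÷q-1÷c p q c 1≤q 1≤c 1+q≡cp = p≡q+r⇒p-r≡q (sym (trans (÷-+ 1 (q * c) 1 c 1≤qc 1≤c)
  (÷-cong _ (q * c * c) p q (ℕP.*-mono-≤ 1≤qc 1≤c) 1≤q cross)))
  where
  open ≡-Reasoning
  1≤qc = ℕP.*-mono-≤ 1≤q 1≤c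
  cross : (1 * c + 1 * (q * c)) * q ≡ p * (q * c * c)
  cross = begin
    (1 * c + 1 * (q * c)) * q ≡⟨ expand q c ⟩
    q * c * suc q             ≡⟨ cong (q * c *_) 1+q≡cp ⟩
    q * c * (c * p)           ≡⟨ regroup q c p ⟩
    p * (q * c * c)           ∎
    where
    expand : ∀ q c → (1 * c + 1 * (q * c)) * q ≡ q * c * suc q
    expand = solve-∀
    regroup : ∀ q c p → q * c * (c * p) ≡ p * (q * c * c)
    regroup = solve-∀

greedyRem≡θ-partialSum : ∀ θ k → greedyRem θ k ≡ θ Q.- partialSum (greedy θ) k
greedyRem≡θ-partialSum θ zero    = solve 1 (λ θ → θ := θ :- con 0ℚ) refl θ
greedyRem≡θ-partialSum θ (suc k) = trans (cong (Q._- inv (greedy θ (suc k))) (greedyRem≡θ-partialSum θ k))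
  (solve 3 (λ θ s v → θ :- s :- v := θ :- (s :+ v)) refl θ (partialSum (greedy θ) k) (inv (greedy θ (suc k))))

greedy-pos : ∀ θ i → 1 ≤ i → 1 ≤ greedy θ i
greedy-pos θ (suc i) _ = G≥1 (greedyRem θ i)

module GreedyOfDivisor (p q c : ℕ) (1≤p : 1 ≤ p) (1≤q : 1 ≤ q) (1+q≡cp : suc q ≡ c * p) where

  θ : ℚ
  θ = p ÷ q

  a : ℕ → ℕ
  a = greedy θ

  1≤c : 1 ≤ c
  1≤c = 1+n≡m*o⇒1≤m c 1+q≡cp

  G-θ : G θ ≡ c
  G-θ = G-p÷q p q c 1≤p 1≤q 1+q≡cp

  remainder : ∀ k → greedyRem θ (suc k) ≡ 1 ÷ (q * prodℕ a (suc k))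
  remainder zero = begin
    θ Q.- inv (G θ)       ≡⟨ cong (λ m → θ Q.- inv m) G-θ ⟩
    θ Q.- inv c           ≡⟨ cong (λ r → θ Q.- r) (inv≡1÷ c) ⟩
    θ Q.- 1 ÷ c           ≡⟨ p÷q-1÷c p q c 1≤q 1≤c 1+q≡cp ⟩
    1 ÷ (q * c)           ≡⟨ cong (λ m → 1 ÷ (q * m)) (trans (ℕP.*-identityˡ (G θ)) G-θ) ⟨
    1 ÷ (q * (1 * G θ))   ∎
    where open ≡-Reasoning
  remainder (suc k) = begin
    R Q.- inv (G R)       ≡⟨ cong₂ (λ r m → r Q.- inv m) (remainder k) G-R ⟩
    1 ÷ M Q.- 1 ÷ suc M   ≡⟨ 1÷M-1÷[1+M] M 1≤M ⟩
    1 ÷ (M * suc M)       ≡⟨ cong (1 ÷_) (trans (ℕP.*-assoc q A (suc M)) (cong (λ m → q * (A * m)) (sym G-R))) ⟩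
    1 ÷ (q * (A * G R))   ∎
    where
    open ≡-Reasoning
    R = greedyRem θ (suc k)
    A = prodℕ a (suc k)
    M = q * A
    1≤M : 1 ≤ M
    1≤M = ℕP.*-mono-≤ 1≤q (prodℕ-pos a (suc k) (λ i 1≤i _ → greedy-pos θ i 1≤i))
    G-R : G R ≡ suc M
    G-R = trans (cong G (remainder k)) (G-1÷ M 1≤M)

  θ≡partialSum+remainder : ∀ k → θ ≡ partialSum a (suc k) Q.+ 1 ÷ (q * prodℕ a (suc k))
  θ≡partialSum+remainder k = trans (solve 2 (λ θ s → θ := s :+ (θ :- s)) refl θ (partialSum a (suc k)))
    (cong (partialSum a (suc k) Q.+_) (trans (sym (greedyRem≡θ-partialSum θ (suc k))) (remainder k)))

  partialSum-<-greedy : ∀ n x m → Upto n (λ i → 1 ≤ x i) → ChainUpto _≤_ n x → 1 ≤ m → m ≤ n →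
    prodℕ x m < prodℕ a m → (∀ k → m < k → k ≤ n → ¬ prodℕ x k < prodℕ a k) →
    partialSum x n Q.< θ → partialSum x n Q.< partialSum a n
  partialSum-<-greedy n x m@(suc k) 1≤x x↑ _ m≤n Πx<Πa above Σx<θ = begin-strict
    partialSum x n                                 ≡⟨ split x ⟩
    partialSum x m Q.+ partialSum (λ i → x (m + i)) L <⟨ QP.+-mono-<-≤ head tail ⟩
    partialSum a m Q.+ partialSum (λ i → a (m + i)) L ≡⟨ split a ⟨
    partialSum a n                                 ∎
    where
    open QP.≤-Reasoning
    L = n ∸ m
    m+L≡n = ℕP.m+[n∸m]≡n m≤n
    split : ∀ f → partialSum f n ≡ partialSum f m Q.+ partialSum (λ i → f (m + i)) L
    split f = trans (cong (partialSum f) (sym m+L≡n)) (partialSum-+ f m L)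
    head : partialSum x m Q.< partialSum a m
    head = +-cancelʳ-< (subst (partialSum x m Q.+ 1 ÷ (q * prodℕ a m) Q.<_) (θ≡partialSum+remainder k)
      (partialSum-gap x m p q (prodℕ a m) 1≤q (upto-take m≤n 1≤x) Πx<Πa
        (QP.≤-<-trans (partialSum-mono x m≤n) Σx<θ)))
    dominated : Upto L (λ j → prodℕ (λ i → a (m + i)) j ≤ prodℕ (λ i → x (m + i)) j)
    dominated j 1≤j j≤L = ℕP.≮⇒≥ λ Πx′<Πa′ → above (m + j) (ℕP.m<m+n m 1≤j)
      (ℕP.≤-trans (ℕP.+-monoʳ-≤ m j≤L) (ℕP.≤-reflexive m+L≡n))
      (subst₂ _<_ (sym (prodℕ-+ x m j)) (sym (prodℕ-+ a m j)) (ℕP.*-mono-< Πx<Πa Πx′<Πa′))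
    tail : partialSum (λ i → x (m + i)) L Q.≤ partialSum (λ i → a (m + i)) L
    tail = partialSum-≤ L (λ i → x (m + i)) (λ i → a (m + i))
      (upto-drop m L (ℕP.≤-reflexive m+L≡n) 1≤x)
      (upto-drop m L (ℕP.≤-reflexive m+L≡n) (λ i 1≤i _ → greedy-pos θ i 1≤i))
      (chainUpto-drop _≤_ n m L x (ℕP.≤-reflexive m+L≡n) x↑) dominated

  greedy-maximal : ∀ n x → Upto n (λ i → 1 ≤ x i) → ChainUpto _≤_ n x →
    partialSum a n Q.≤ partialSum x n → partialSum x n Q.< θ → Upto n (λ i → x i ≡ a i)
  greedy-maximal zero    _ _   _  _     _    = upto-zero
  greedy-maximal (suc n) x 1≤x x↑ Σa≤Σx Σx<θ with search-last (λ k → prodℕ x k ℕ.<? prodℕ a k) (suc n)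
  ... | inj₁ (m , 1≤m , m≤n , Πx<Πa , above) =
    ⊥-elim (QP.<-irrefl refl
      (QP.<-≤-trans (partialSum-<-greedy (suc n) x m 1≤x x↑ 1≤m m≤n Πx<Πa above Σx<θ) Σa≤Σx))
  ... | inj₂ none with partialSum-<-or-≡ n x a 1≤x (λ i 1≤i _ → greedy-pos θ i 1≤i) x↑
                         (λ k 1≤k k≤n → ℕP.≮⇒≥ (none k 1≤k k≤n))
  ...   | inj₁ Σx<Σa = ⊥-elim (QP.<-irrefl refl (QP.<-≤-trans Σx<Σa Σa≤Σx))
  ...   | inj₂ x≡a   = x≡a

theorem4p2 : (p q : ℕ) → .{{_ : NonZero q}} → 1 ≤ p → p ≤ q → p ∣ suc q →
    (n : ℕ) → 1 ≤ n → (x : ℕ → ℕ) →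
    2 ≤ x 1 → (∀ i → 1 ≤ i → i < n → x i ≤ x (suc i)) →
    partialSum (greedy ((+ p) / q)) n Q.≤ partialSum x n →
    partialSum x n Q.< (+ p) / q →
    ∀ i → 1 ≤ i → i ≤ n → x i ≡ greedy ((+ p) / q) i
theorem4p2 p (suc q) 1≤p _ (divides c 1+q≡cp) n _ x 2≤x₁ x↑ =
  GreedyOfDivisor.greedy-maximal p (suc q) c 1≤p (s≤s z≤n) 1+q≡cp n x 1≤x x↑
  where
  1≤x : Upto n (λ i → 1 ≤ x i)
  1≤x i 1≤i i≤n = ℕP.≤-trans (s≤s z≤n)
    (ℕP.≤-trans 2≤x₁ (chainUpto⇒related _≤_ ℕP.≤-refl ℕP.≤-trans n x x↑ 1 i ℕP.≤-refl 1≤i i≤n))
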